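{- Let $H$ be an $r$-uniform hypergraph with $r \geq 3$, and let $H_{p,q}$ be any $(p,q)$-extension of $H$ (as defined in the context). Then $\chi(H_{p,q}) = \chi(H)$.
   Context: A hypergraph $H$ consists of a finite vertex set $V(H)$ and a family $E(H)$ of subsets of $V(H)$ (edges); it is $r$-uniform if every edge has exactly $r$ vertices. A classical colouring of an $r$-uniform hypergraph is an assignment of colours to vertices such that no edge is monochromatic; the chromatic number $\chi(H)$ is the minimum number of colours in such a colouring. $(p,q)$-extension: Let $H$ be $r$-uniform, $r\ge 3$, and let $E^*=\{v_1,\dots,v_r\}$ be an edge of $H$. Let $W=\{w_1,\dots,w_p\}$ ($p\ge 1$) and $U=\{u_1,\dots,u_q\}$ ($q \ge 0$) be sets of new vertices, pairwise disjoint from each other and from $V(H)$. Let $T$ be a non-empty subset of $\{1,2,\dots,\min\{p,\lfloor (r-1)/2\rfloor\}\}$. If $q\ge 1$, let $P$ be a non-empty subset of $\{1,\dots,\min\{p,r-2\}\}$ and $Q$ a non-empty subset of $\{1,\dots,\min\{q,r-2\}\}$ such that there exist $x\in P$, $y\in Q$ with $x+y\le r-1$. The $(p,q)$-extension $H_{p,q}$ has vertex set $V(H)\cup W\cup U$ and edge set consisting of all edges of $H$ together with: (Type 1) every $r$-set $K\subseteq E^*\cup W$ with $|K\cap W|\in T$; (Type 2, only when $q\ge 1$) every $r$-set $K\subseteq E^*\cup W\cup U$ with $|K\cap W|\in P$, $|K\cap U|\in Q$ and $|K\cap W|+|K\cap U|\le r-1$ (so the remaining $r-|K\cap W|-|K\cap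 U|$ vertices of $K$ lie in $E^*$). When $q=0$ there are no Type 2 edges. -}

module Defs where

open import Data.Nat using (ℕ; _+_; _*_; _∸_; _≤_; _<_; ⌊_/2⌋)
open import Data.Fin using (Fin)
open import Data.Fin.Subset using (Subset; _∈_; _⊆_; ∣_∣) renaming (⊥ to ∅)
open import Data.Vec using (take; drop; _++_)
open import Data.Product using (Σ; ∃; _×_)
open import Data.Sum using (_⊎_)
open import Relation.Binary.PropositionalEquality using (_≡_)
open import Relation.Nullary using (¬_)

record Hypergraph : Set₁ where
  field
    n     : ℕ
    edges : Subset n → Set
open Hypergraph public

Uniform : ℕ → Hypergraph → Set
Uniform r H = ∀ e → edges H e → ∣ e ∣ ≡ r

Monochromatic : ∀ {n k} → (Fin n → Fin k) → Subset n → Set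
Monochromatic c e = ∀ u v → u ∈ e → v ∈ e → c u ≡ c v

ProperColouring : (H : Hypergraph) (k : ℕ) → (Fin (n H) → Fin k) → Set
ProperColouring H k c = ∀ e → edges H e → ¬ Monochromatic c e

Colourable : Hypergraph → ℕ → Set
Colourable H k = Σ (Fin (n H) → Fin k) (ProperColouring H k)

IsChromaticNumber : Hypergraph → ℕ → Set
IsChromaticNumber H k = Colourable H k × (∀ j → j < k → ¬ Colourable H j)

-- (p,q)-extension.  The new vertex set is Fin (n + (p + q)):
-- the first n vertices are V(H), the next p are W, the last q are U.
module _ {n p q : ℕ} (K : Subset (n + (p + q))) where
  oldPart : Subset n
  oldPart = take n K
  wPart : Subset p
  wPart = take p (drop n K)
  uPart : Subset q
  uPart = drop p (drop n K)

ExtensionEdges : (H : Hypergraph) (r p q : ℕ) (Estar : Subset (n H))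
                 (T P Q : ℕ → Set) → Subset (n H + (p + q)) → Set
ExtensionEdges H r p q Estar T P Q K =
    (Σ (Subset (n H)) λ e → edges H e × K ≡ e ++ ∅)
  ⊎
    (∣ K ∣ ≡ r × oldPart {n H} {p} {q} K ⊆ Estar × uPart {n H} {p} {q} K ≡ ∅
       × T ∣ wPart {n H} {p} {q} K ∣)
  ⊎
    (∣ K ∣ ≡ r × oldPart {n H} {p} {q} K ⊆ Estar
       × P ∣ wPart {n H} {p} {q} K ∣ × Q ∣ uPart {n H} {p} {q} K ∣
       × ∣ wPart {n H} {p} {q} K ∣ + ∣ uPart {n H} {p} {q} K ∣ ≤ r ∸ 1)

Extension : (H : Hypergraph) (r p q : ℕ) (Estar : Subset (n H))
            (T P Q : ℕ → Set) → Hypergraph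
Extension H r p q Estar T P Q = record
  { n = n H + (p + q)
  ; edges = ExtensionEdges H r p q Estar T P Q }

ValidT : (r p : ℕ) → (ℕ → Set) → Set
ValidT r p T = (∃ λ t → T t) × (∀ t → T t → 1 ≤ t × t ≤ p × t ≤ ⌊ r ∸ 1 /2⌋)

-- P ⊆ {1..min(p,r-2)}, Q ⊆ {1..min(q,r-2)}; if q ≥ 1 they are nonempty and
-- some x ∈ P, y ∈ Q have x + y ≤ r - 1.  (When q = 0, Q is forced empty,
-- so there are no Type 2 edges.)
ValidPQ : (r p q : ℕ) → (ℕ → Set) → (ℕ → Set) → Set
ValidPQ r p q P Q =
    (∀ x → P x → 1 ≤ x × x ≤ p × x ≤ r ∸ 2)
  × (∀ y → Q y → 1 ≤ y × y ≤ q × y ≤ r ∸ 2)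
  × (1 ≤ q → (∃ λ x → P x) × (∃ λ y → Q y)
             × (∃ λ x → ∃ λ y → P x × Q y × x + y ≤ r ∸ 1))

-- A colouring of H_{p,q} restricts to one of H.  Conversely, a proper colouring
-- of H is not monochromatic on E*, so E* sees two colours α ≠ β; take α to be
-- the rarer of the two on E*, so at most r/2 vertices of E* have colour α.
-- Colour W with α and U with β.  A Type 2 edge meets both W and U.  A Type 1
-- edge with t ≤ (r−1)/2 vertices in W has r − t > r/2 vertices in E*, so not
-- all of them have colour α.
module Submission where

open import Defs
open import Data.Nat using (ℕ; zero; suc; _+_; _∸_; _≤_; _<_; _≤?_; z≤n; s≤s; ⌊_/2⌋; ⌈_/2⌉)
open import Data.Nat.Properties
  using ( ≤-trans; ≤-reflexive; <⇒≤; <⇒≢; <⇒≱; ≰⇒>; +-suc; +-identityʳ; +-mono-≤; +-monoʳ-≤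
        ; +-cancelˡ-≤; +-cancelʳ-<; ⌊n/2⌋≤⌈n/2⌉; ⌊n/2⌋+⌈n/2⌉≡n; module ≤-Reasoning)
open import Data.Fin using (Fin; _≟_; _↑ˡ_; _↑ʳ_; splitAt) renaming (zero to fzero; suc to fsuc)
open import Data.Fin.Properties using (any?; splitAt-↑ˡ; splitAt-↑ʳ)
open import Data.Fin.Subset using (Subset; _∈_; _⊆_; _∩_; ∣_∣; Nonempty; Empty; inside; outside) renaming (⊥ to ∅)
open import Data.Fin.Subset.Properties
  using ( _∈?_; nonempty?; Empty-unique; ∉⊥; ∣⊥∣≡0; ∣p∣≤∣x∷p∣; p⊆q⇒∣p∣≤∣q∣; drop-∷-⊆; drop-∷-Empty
        ; p∩q⊆p; x∈p∩q⁺; x∈p∩q⁻)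
open import Data.Vec using ([]; _∷_; take; drop; _++_; tabulate; here; there)
open import Data.Vec.Properties
  using (take++drop≡id; lookup-++ˡ; lookup-++ʳ; lookup∘tabulate; []=⇒lookup; lookup⇒[]=)
open import Data.Bool.Properties using (T-≡)
open import Data.Empty using (⊥-elim)
open import Data.Product using (∃; ∃₂; _×_; _,_; proj₁)
open import Data.Sum using ([_,_]; inj₁; inj₂)
open import Relation.Nullary using (Dec; yes; no; ¬_; _×-dec_; ¬?; contradiction)
open import Relation.Nullary.Decidable using (isYes; toWitness; fromWitness; decidable-stable)
open import Relation.Binary.PropositionalEquality
  using (_≡_; _≢_; refl; sym; trans; cong; subst; module ≡-Reasoning)
open import Function using (_∘_; const)
open import Function.Bundles using (_⇔_; Equivalence; mk⇔)

∣xs++ys∣≡∣xs∣+∣ys∣ : ∀ {m n} (xs : Subset m) (ys : Subset n) → ∣ xs ++ ys ∣ ≡ ∣ xs ∣ + ∣ ys ∣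
∣xs++ys∣≡∣xs∣+∣ys∣ []             ys = refl
∣xs++ys∣≡∣xs∣+∣ys∣ (inside  ∷ xs) ys = cong suc (∣xs++ys∣≡∣xs∣+∣ys∣ xs ys)
∣xs++ys∣≡∣xs∣+∣ys∣ (outside ∷ xs) ys = ∣xs++ys∣≡∣xs∣+∣ys∣ xs ys

∣xs∣≡∣take∣+∣drop∣ : ∀ m {n} (xs : Subset (m + n)) → ∣ xs ∣ ≡ ∣ take m xs ∣ + ∣ drop m xs ∣
∣xs∣≡∣take∣+∣drop∣ m xs =
  trans (cong ∣_∣ (sym (take++drop≡id m xs))) (∣xs++ys∣≡∣xs∣+∣ys∣ (take m xs) (drop m xs))

∈-++⁺ˡ : ∀ {m n} {xs : Subset m} (ys : Subset n) {i} → i ∈ xs → (i ↑ˡ n) ∈ xs ++ ys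
∈-++⁺ˡ {xs = xs} ys {i} i∈xs =
  lookup⇒[]= _ (xs ++ ys) (trans (lookup-++ˡ xs ys i) ([]=⇒lookup i∈xs))

∈-++⁺ʳ : ∀ {m n} (xs : Subset m) {ys : Subset n} {i} → i ∈ ys → (m ↑ʳ i) ∈ xs ++ ys
∈-++⁺ʳ xs {ys} {i} i∈ys =
  lookup⇒[]= _ (xs ++ ys) (trans (lookup-++ʳ xs ys i) ([]=⇒lookup i∈ys))

∈-++⊥⁻ : ∀ {m n} (xs : Subset m) {j} → j ∈ xs ++ ∅ {n} → ∃ λ i → i ∈ xs × j ≡ i ↑ˡ n
∈-++⊥⁻ []       j∈         = ⊥-elim (∉⊥ j∈)
∈-++⊥⁻ (_ ∷ xs) here       = fzero , here , refl
∈-++⊥⁻ (_ ∷ xs) (there j∈) with ∈-++⊥⁻ xs j∈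
... | i , i∈xs , refl = fsuc i , there i∈xs , refl

∈-take⇒↑ˡ∈ : ∀ m {n} (xs : Subset (m + n)) {i} → i ∈ take m xs → (i ↑ˡ n) ∈ xs
∈-take⇒↑ˡ∈ m xs i∈ = subst (_ ∈_) (take++drop≡id m xs) (∈-++⁺ˡ (drop m xs) i∈)

∈-drop⇒↑ʳ∈ : ∀ m {n} (xs : Subset (m + n)) {i} → i ∈ drop m xs → (m ↑ʳ i) ∈ xs
∈-drop⇒↑ʳ∈ m xs i∈ = subst (_ ∈_) (take++drop≡id m xs) (∈-++⁺ʳ (take m xs) i∈)

1≤∣p∣⇒Nonempty : ∀ {m} {p : Subset m} → 1 ≤ ∣ p ∣ → Nonempty p
1≤∣p∣⇒Nonempty {m} {p} 1≤∣p∣ = decidable-stable (nonempty? p) λ p-empty →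
  <⇒≢ 1≤∣p∣ (sym (trans (cong ∣_∣ (Empty-unique p-empty)) (∣⊥∣≡0 m)))

disjoint⇒∣p∣+∣q∣≤∣r∣ : ∀ {m} {p q r : Subset m} →
  p ⊆ r → q ⊆ r → Empty (p ∩ q) → ∣ p ∣ + ∣ q ∣ ≤ ∣ r ∣
disjoint⇒∣p∣+∣q∣≤∣r∣ {p = []} {[]} {[]} _ _ _ = z≤n
disjoint⇒∣p∣+∣q∣≤∣r∣ {p = inside ∷ _} {inside ∷ _} _ _ disjoint = ⊥-elim (disjoint (fzero , here))
disjoint⇒∣p∣+∣q∣≤∣r∣ {p = inside ∷ _} {outside ∷ _} {outside ∷ _} p⊆r _ _ = contradiction (p⊆r here) λ ()
disjoint⇒∣p∣+∣q∣≤∣r∣ {p = outside ∷ _} {inside ∷ _} {outside ∷ _} _ q⊆r _ = contradiction (q⊆r here) λ ()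
disjoint⇒∣p∣+∣q∣≤∣r∣ {p = inside ∷ _} {outside ∷ _} {inside ∷ _} p⊆r q⊆r disjoint =
  s≤s (disjoint⇒∣p∣+∣q∣≤∣r∣ (drop-∷-⊆ p⊆r) (drop-∷-⊆ q⊆r) (drop-∷-Empty disjoint))
disjoint⇒∣p∣+∣q∣≤∣r∣ {p = outside ∷ p} {inside ∷ q} {inside ∷ _} p⊆r q⊆r disjoint =
  ≤-trans (≤-reflexive (+-suc ∣ p ∣ ∣ q ∣))
          (s≤s (disjoint⇒∣p∣+∣q∣≤∣r∣ (drop-∷-⊆ p⊆r) (drop-∷-⊆ q⊆r) (drop-∷-Empty disjoint)))
disjoint⇒∣p∣+∣q∣≤∣r∣ {p = outside ∷ _} {outside ∷ _} {s ∷ r} p⊆r q⊆r disjoint =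
  ≤-trans (disjoint⇒∣p∣+∣q∣≤∣r∣ (drop-∷-⊆ p⊆r) (drop-∷-⊆ q⊆r) (drop-∷-Empty disjoint)) (∣p∣≤∣x∷p∣ s r)

m+m<n : ∀ {m n} → 1 ≤ m → m ≤ ⌊ n ∸ 1 /2⌋ → m + m < n
m+m<n {n = zero}  1≤m m≤0 = contradiction m≤0 (<⇒≱ 1≤m)
m+m<n {m} {suc n} _   m≤  = s≤s (begin
  m + m              ≤⟨ +-mono-≤ m≤ (≤-trans m≤ (⌊n/2⌋≤⌈n/2⌉ n)) ⟩
  ⌊ n /2⌋ + ⌈ n /2⌉  ≡⟨ ⌊n/2⌋+⌈n/2⌉≡n n ⟩
  n                  ∎)
  where open ≤-Reasoning

fibre : ∀ {m k} → (Fin m → Fin k) → Fin k → Subset m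
fibre c x = tabulate (λ i → isYes (c i ≟ x))

∈-fibre⁺ : ∀ {m k} {c : Fin m → Fin k} {x i} → c i ≡ x → i ∈ fibre c x
∈-fibre⁺ {c = c} {x} {i} ci≡x =
  lookup⇒[]= i _ (trans (lookup∘tabulate _ i) (Equivalence.to T-≡ (fromWitness ci≡x)))

∈-fibre⁻ : ∀ {m k} {c : Fin m → Fin k} {x i} → i ∈ fibre c x → c i ≡ x
∈-fibre⁻ {c = c} {x} {i} i∈ =
  toWitness {a? = c i ≟ x} (Equivalence.from T-≡ (trans (sym (lookup∘tabulate _ i)) ([]=⇒lookup i∈)))

∣S∩fibre∣+∣S∩fibre∣≤∣S∣ : ∀ {m k} (c : Fin m → Fin k) (S : Subset m) {α β} → α ≢ β →
  ∣ S ∩ fibre c α ∣ + ∣ S ∩ fibre c β ∣ ≤ ∣ S ∣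
∣S∩fibre∣+∣S∩fibre∣≤∣S∣ c S {α} {β} α≢β =
  disjoint⇒∣p∣+∣q∣≤∣r∣ (p∩q⊆p S (fibre c α)) (p∩q⊆p S (fibre c β)) λ (i , i∈) →
    let i∈α , i∈β = x∈p∩q⁻ (S ∩ fibre c α) (S ∩ fibre c β) i∈
    in α≢β (trans (sym (colour i∈α)) (colour i∈β))
  where
  colour : ∀ {x i} → i ∈ S ∩ fibre c x → c i ≡ x
  colour {x} i∈ with x∈p∩q⁻ S (fibre c x) i∈
  ... | _ , i∈fibre = ∈-fibre⁻ i∈fibre

Bichromatic : ∀ {m k} → (Fin m → Fin k) → Subset m → Set
Bichromatic c S = ∃₂ λ u v → u ∈ S × v ∈ S × c u ≢ c v

¬monochromatic⇒bichromatic : ∀ {m k} (c : Fin m → Fin k) (S : Subset m) →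
  ¬ Monochromatic c S → Bichromatic c S
¬monochromatic⇒bichromatic c S ¬mono = decidable-stable bichromatic? λ ¬bi →
  ¬mono λ u v u∈S v∈S → decidable-stable (c u ≟ c v) λ cu≢cv → ¬bi (u , v , u∈S , v∈S , cu≢cv)
  where
  bichromatic? : Dec (Bichromatic c S)
  bichromatic? = any? λ u → any? λ v → (u ∈? S) ×-dec (v ∈? S) ×-dec ¬? (c u ≟ c v)

rare-colour : ∀ {m k} (c : Fin m → Fin k) (S : Subset m) → ¬ Monochromatic c S →
  ∃₂ λ α β → α ≢ β × ∣ S ∩ fibre c α ∣ + ∣ S ∩ fibre c α ∣ ≤ ∣ S ∣
rare-colour c S ¬mono with ¬monochromatic⇒bichromatic c S ¬mono
... | u , v , _ , _ , cu≢cv with ∣ S ∩ fibre c (c u) ∣ ≤? ∣ S ∩ fibre c (c v) ∣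
...   | yes u-rarer = c u , c v , cu≢cv ,
  ≤-trans (+-monoʳ-≤ _ u-rarer) (∣S∩fibre∣+∣S∩fibre∣≤∣S∣ c S cu≢cv)
...   | no  v-rarer = c v , c u , cu≢cv ∘ sym ,
  ≤-trans (+-monoʳ-≤ _ (<⇒≤ (≰⇒> v-rarer))) (∣S∩fibre∣+∣S∩fibre∣≤∣S∣ c S (cu≢cv ∘ sym))

monochromatic-++⊥ : ∀ {m n k} {c : Fin (m + n) → Fin k} (e : Subset m) →
  Monochromatic (c ∘ (_↑ˡ n)) e → Monochromatic c (e ++ ∅ {n})
monochromatic-++⊥ e mono u v u∈ v∈ with ∈-++⊥⁻ e u∈ | ∈-++⊥⁻ e v∈
... | i , i∈e , refl | j , j∈e , refl = mono i j i∈e j∈e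

module _ (H : Hypergraph) (r p q : ℕ) (Estar : Subset (n H)) (T P Q : ℕ → Set) where

  private
    N : ℕ
    N = n H

    Hpq : Hypergraph
    Hpq = Extension H r p q Estar T P Q

    old : Subset (N + (p + q)) → Subset N
    old = oldPart {N} {p} {q}

    w : Subset (N + (p + q)) → Subset p
    w = wPart {N} {p} {q}

    u : Subset (N + (p + q)) → Subset q
    u = uPart {N} {p} {q}

    oldVertex : Fin N → Fin (N + (p + q))
    oldVertex i = i ↑ˡ (p + q)

    wVertex : Fin p → Fin (N + (p + q))
    wVertex i = N ↑ʳ (i ↑ˡ q)

    uVertex : Fin q → Fin (N + (p + q))
    uVertex i = N ↑ʳ (p ↑ʳ i)

    ∈-old : ∀ K {i} → i ∈ old K → oldVertex i ∈ K
    ∈-old K = ∈-take⇒↑ˡ∈ N K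

    ∈-w : ∀ K {i} → i ∈ w K → wVertex i ∈ K
    ∈-w K i∈ = ∈-drop⇒↑ʳ∈ N K (∈-take⇒↑ˡ∈ p (drop N K) i∈)

    ∈-u : ∀ K {i} → i ∈ u K → uVertex i ∈ K
    ∈-u K i∈ = ∈-drop⇒↑ʳ∈ N K (∈-drop⇒↑ʳ∈ p (drop N K) i∈)

    ∣K∣≡∣old∣+∣w∣+∣u∣ : ∀ K → ∣ K ∣ ≡ ∣ old K ∣ + (∣ w K ∣ + ∣ u K ∣)
    ∣K∣≡∣old∣+∣w∣+∣u∣ K =
      trans (∣xs∣≡∣take∣+∣drop∣ N K) (cong (∣ old K ∣ +_) (∣xs∣≡∣take∣+∣drop∣ p (drop N K)))

  colourable-restrict : ∀ {k} → Colourable Hpq k → Colourable H k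
  colourable-restrict (c , proper) =
    c ∘ oldVertex , λ e e∈H mono → proper (e ++ ∅) (inj₁ (e , e∈H , refl)) (monochromatic-++⊥ e mono)

  module _ {k} (c : Fin N → Fin k) (α β : Fin k) where

    extendColouring : Fin (N + (p + q)) → Fin k
    extendColouring = [ c , [ const α , const β ] ∘ splitAt p ] ∘ splitAt N

    extend-old : ∀ i → extendColouring (oldVertex i) ≡ c i
    extend-old i rewrite splitAt-↑ˡ N i (p + q) = refl

    extend-w : ∀ i → extendColouring (wVertex i) ≡ α
    extend-w i rewrite splitAt-↑ʳ N (p + q) (i ↑ˡ q) | splitAt-↑ˡ p i q = refl

    extend-u : ∀ i → extendColouring (uVertex i) ≡ β
    extend-u i rewrite splitAt-↑ʳ N (p + q) (p ↑ʳ i) | splitAt-↑ʳ p q i = refl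

    extendColouring-proper : ValidT r p T → ValidPQ r p q P Q → ProperColouring H k c →
      α ≢ β → ∣ Estar ∩ fibre c α ∣ + ∣ Estar ∩ fibre c α ∣ ≤ r →
      ProperColouring Hpq k extendColouring
    extendColouring-proper _ _ proper _ _ K (inj₁ (e , e∈H , refl)) mono =
      proper e e∈H λ i j i∈e j∈e →
        trans (sym (extend-old i)) (trans (mono _ _ (∈-++⁺ˡ ∅ i∈e) (∈-++⁺ˡ ∅ j∈e)) (extend-old j))
    extendColouring-proper (_ , T-bounds) _ _ _ rare K (inj₂ (inj₁ (∣K∣≡r , old⊆Estar , u≡∅ , T∣w∣))) mono
      with T-bounds _ T∣w∣
    ... | 1≤∣w∣ , _ , ∣w∣≤ with 1≤∣p∣⇒Nonempty 1≤∣w∣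
    ... | v , v∈w = <⇒≱ ∣w∣<∣old∣ ∣old∣≤∣w∣
      where
      old⊆class : old K ⊆ Estar ∩ fibre c α
      old⊆class {i} i∈ = x∈p∩q⁺ (old⊆Estar i∈ , ∈-fibre⁺
        (trans (sym (extend-old i)) (trans (mono _ _ (∈-old K i∈) (∈-w K v∈w)) (extend-w v))))
      r≡ : r ≡ ∣ old K ∣ + ∣ w K ∣
      r≡ = begin
        r                                   ≡⟨ sym ∣K∣≡r ⟩
        ∣ K ∣                               ≡⟨ ∣K∣≡∣old∣+∣w∣+∣u∣ K ⟩
        ∣ old K ∣ + (∣ w K ∣ + ∣ u K ∣)     ≡⟨ cong (λ U → ∣ old K ∣ + (∣ w K ∣ + ∣ U ∣)) u≡∅ ⟩
        ∣ old K ∣ + (∣ w K ∣ + ∣ ∅ {q} ∣)   ≡⟨ cong (λ s → ∣ old K ∣ + (∣ w K ∣ + s)) (∣⊥∣≡0 q) ⟩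
        ∣ old K ∣ + (∣ w K ∣ + 0)           ≡⟨ cong (∣ old K ∣ +_) (+-identityʳ _) ⟩
        ∣ old K ∣ + ∣ w K ∣                 ∎
        where open ≡-Reasoning
      ∣w∣<∣old∣ : ∣ w K ∣ < ∣ old K ∣
      ∣w∣<∣old∣ = +-cancelʳ-< _ _ _ (subst (_ <_) r≡ (m+m<n 1≤∣w∣ ∣w∣≤))
      ∣old∣≤∣w∣ : ∣ old K ∣ ≤ ∣ w K ∣
      ∣old∣≤∣w∣ = +-cancelˡ-≤ _ _ _ (begin
        ∣ old K ∣ + ∣ old K ∣  ≤⟨ +-mono-≤ (p⊆q⇒∣p∣≤∣q∣ old⊆class) (p⊆q⇒∣p∣≤∣q∣ old⊆class) ⟩
        _                      ≤⟨ rare ⟩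
        r                      ≡⟨ r≡ ⟩
        ∣ old K ∣ + ∣ w K ∣    ∎)
        where open ≤-Reasoning
    extendColouring-proper _ (P-bounds , Q-bounds , _) _ α≢β _ K (inj₂ (inj₂ (_ , _ , P∣w∣ , Q∣u∣ , _))) mono
      with 1≤∣p∣⇒Nonempty (proj₁ (P-bounds _ P∣w∣)) | 1≤∣p∣⇒Nonempty (proj₁ (Q-bounds _ Q∣u∣))
    ... | v , v∈w | v′ , v′∈u =
      α≢β (trans (sym (extend-w v)) (trans (mono _ _ (∈-w K v∈w) (∈-u K v′∈u)) (extend-u v′)))

  colourable-extend : Uniform r H → edges H Estar → ValidT r p T → ValidPQ r p q P Q →
    ∀ {k} → Colourable H k → Colourable Hpq k
  colourable-extend uniform Estar∈H validT validPQ (c , proper)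
    with rare-colour c Estar (proper Estar Estar∈H)
  ... | α , β , α≢β , rare =
    extendColouring c α β ,
    extendColouring-proper c α β validT validPQ proper α≢β (subst (_ ≤_) (uniform Estar Estar∈H) rare)

same-colourability⇒same-chromatic-number : ∀ {G G′ : Hypergraph} →
  (∀ {k} → Colourable G k → Colourable G′ k) → (∀ {k} → Colourable G′ k → Colourable G k) →
  ∀ k → IsChromaticNumber G k ⇔ IsChromaticNumber G′ k
same-colourability⇒same-chromatic-number to from k = mk⇔
  (λ (colourable , minimal) → to colourable , λ j j<k → minimal j j<k ∘ from)
  (λ (colourable , minimal) → from colourable , λ j j<k → minimal j j<k ∘ to)

-- The hypotheses 3 ≤ r and 1 ≤ p are implied by ValidT r p T.
theorem2p1 : (r : ℕ) (H : Hypergraph) → 3 ≤ r → Uniform r H →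
    (Estar : Subset (Hypergraph.n H)) → Hypergraph.edges H Estar →
    (p q : ℕ) → 1 ≤ p → (T P Q : ℕ → Set) → ValidT r p T → ValidPQ r p q P Q →
    (k : ℕ) → IsChromaticNumber H k ⇔ IsChromaticNumber (Extension H r p q Estar T P Q) k
theorem2p1 r H _ uniform Estar Estar∈H p q _ T P Q validT validPQ =
  same-colourability⇒same-chromatic-number
    (colourable-extend H r p q Estar T P Q uniform Estar∈H validT validPQ)
    (colourable-restrict H r p q Estar T P Q)
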